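{- Let $m$ be a positive integer and let $\ell=\ell(m)$ be the largest integer with $\ell^{\ell}\le m$. Then for any preference lists of $m$ buyers, either $\left|\bigcap_{\tau}s(\tau)\right|\ge \ell-4$, where the intersection is over all POMs $\tau$, or there is a set $X$ of houses with $|X|\ge \ell^2$ such that every POM $\tau$ satisfies $|s(\tau)\cap X|\ge |X|-\ell$.
   Context: House allocation setting: $A$ is a set of $m$ buyers and $B$ is an infinite (countable) set of houses. Each buyer $a\in A$ has a preference list, i.e., an ordering of all houses of $B$ into a sequence (first choice, second choice, ...), in which a house placed earlier is preferred. A matching is an injective map $\tau:A\to B$. A matching $\tau$ is Pareto optimal (a POM) if there is no nonempty set $A'\subseteq A$ and matching $\tau'$ that differs from $\tau$ only on $A'$ such that for every $a\in A'$ the house $\tau'(a)$ is placed higher in the preference list of $a$ than $\tau(a)$. For a matching $\tau$, $s(\tau)=\{\tau(a):a\in A\}$ is the set of houses sold. -}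

module Defs where

open import Data.Nat using (ℕ; _<_; _≤_; _^_; _*_; _∸_; suc)
open import Data.Fin using (Fin)
open import Data.Fin.Subset using (Subset; _∈_; _∉_; Nonempty)
open import Data.List using (List; length)
open import Data.List.Relation.Unary.All using (All)
open import Data.List.Relation.Unary.Unique.Propositional using (Unique)
open import Data.List.Relation.Binary.Subset.Propositional using (_⊆_)
open import Data.Product using (Σ; ∃; ∃-syntax; _×_)
open import Relation.Binary.PropositionalEquality using (_≡_)
open import Relation.Nullary using (¬_)
open import Function using (_⤖_; Injective)
open import Function.Bundles using (Bijection)

-- Buyers: Fin m.  Houses: ℕ (a countably infinite set).
-- A preference list of a buyer is an ordering of all houses into a
-- sequence: a bijection ℕ ⤖ ℕ, where position i ↦ i-th choice.
Preferences : ℕ → Set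
Preferences m = Fin m → (ℕ ⤖ ℕ)

Prefers : ∀ {m} → Preferences m → Fin m → ℕ → ℕ → Set
Prefers P a h h' = ∃[ i ] ∃[ j ] (i < j × Bijection.to (P a) i ≡ h × Bijection.to (P a) j ≡ h')

record Matching (m : ℕ) : Set where
  field
    τ   : Fin m → ℕ
    inj : Injective _≡_ _≡_ τ
open Matching public

IsPOM : ∀ {m} → Preferences m → Matching m → Set
IsPOM {m} P μ =
  ¬ (Σ (Subset m) λ A′ → Σ (Matching m) λ μ′ →
       Nonempty A′
     × (∀ a → a ∉ A′ → τ μ′ a ≡ τ μ a)
     × (∀ a → a ∈ A′ → Prefers P a (τ μ′ a) (τ μ a)))

Sold : ∀ {m} → Matching m → ℕ → Set
Sold μ h = ∃[ a ] τ μ a ≡ h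

-- |⋂_{POM τ} s(τ)| ≥ k : there are k distinct houses sold in every POM
CoreAtLeast : ∀ {m} → Preferences m → ℕ → Set
CoreAtLeast P k = Σ (List ℕ) λ Y →
  Unique Y × k ≤ length Y × All (λ h → ∀ μ → IsPOM P μ → Sold μ h) Y

SoldInAtLeast : ∀ {m} → Matching m → List ℕ → ℕ → Set
SoldInAtLeast μ X k = Σ (List ℕ) λ Y →
  Unique Y × Y ⊆ X × k ≤ length Y × All (Sold μ) Y

-- Follow the buyers down their preference lists, keeping a large group L
-- of buyers whose first i choices coincide, all of them houses sold in
-- every POM.  In a POM a buyer whose (i+1)-st choice is unsold holds one
-- of its first i choices, and these are shared by L, so at most i buyers
-- of L have an unsold (i+1)-st choice.  Hence, if the (i+1)-st choices of
-- L are spread over at least ℓ² houses, these houses form the set X; a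
-- house that is the (i+1)-st choice of more than i buyers of L is sold in
-- every POM, so if ℓ - 4 such houses exist they form the core.
-- Otherwise, counting shows that a 1/ℓ fraction of L agrees on its
-- (i+1)-st choice, and we continue with that subgroup.  Starting from all
-- ℓ^ℓ ≤ m buyers, ℓ - 4 rounds leave a nonempty group, whose common
-- prefix is the core.
module Submission where

open import Defs
open import Data.Empty using (⊥-elim)
open import Data.Fin using (Fin) renaming (_≟_ to _≟ᶠ_)
open import Data.Fin.Properties using (any?)
open import Data.Fin.Subset using (⁅_⁆) renaming (_∈_ to _∈ₛ_; _∉_ to _∉ₛ_)
open import Data.Fin.Subset.Properties using (x∈⁅x⁆; x∈⁅y⁆⇒x≡y)
open import Data.List
  using (List; []; _∷_; _++_; length; map; filter; allFin; applyDownFrom; deduplicate)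
open import Data.List.Membership.Propositional using (_∈_)
open import Data.List.Membership.Propositional.Properties
  using (∈-map⁺; ∈-map⁻; ∈-++⁺ˡ; ∈-++⁺ʳ; ∈-++⁻; ∈-∃++; ∈-filter⁺; ∈-filter⁻;
         ∈-deduplicate⁺; ∈-deduplicate⁻; ∈-applyDownFrom⁺)
open import Data.List.Properties
  using (length-++; length-map; length-tabulate; filter-accept; filter-reject)
open import Data.List.Relation.Binary.Subset.Propositional using (_⊆_)
open import Data.List.Relation.Unary.All as All using (All; []; _∷_)
import Data.List.Relation.Unary.All.Properties as All
open import Data.List.Relation.Unary.Any as Any using (Any; here; there)
open import Data.List.Relation.Unary.Unique.Propositional using (Unique; []; _∷_)
import Data.List.Relation.Unary.Unique.Propositional.Properties as Unique
open import Data.List.Relation.Unary.Unique.DecPropositional.Properties using (deduplicate-!)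
open import Data.Nat
  using (ℕ; zero; suc; _+_; _*_; _^_; _∸_; _≤_; _<_; z≤n; s≤s; _≟_; _≤?_; _<?_; >-nonZero)
open import Data.Nat.ListAction using (sum)
open import Data.Nat.Properties
open import Data.Nat.Solver using (module +-*-Solver)
open import Data.Product using (Σ; _×_; _,_; proj₁; proj₂)
open import Data.Sum using (_⊎_; inj₁; inj₂; [_,_]′)
open import Function using (_∘_; Injective)
open import Function.Bundles using (Bijection)
open import Relation.Binary.Definitions using (tri<; tri≈; tri>)
open import Relation.Binary.PropositionalEquality
open import Relation.Nullary using (¬_; Dec; yes; no)
open import Relation.Unary using (Decidable)
open import Relation.Unary.Properties using (∁?)

module _ {A : Set} where

  ∈-++-∷⁻ : ∀ {x y : A} us {vs} → y ∈ us ++ x ∷ vs → y ≢ x → y ∈ us ++ vs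
  ∈-++-∷⁻ us y∈ y≢x with ∈-++⁻ us y∈
  ... | inj₁ y∈us         = ∈-++⁺ˡ y∈us
  ... | inj₂ (here y≡x)   = ⊥-elim (y≢x y≡x)
  ... | inj₂ (there y∈vs) = ∈-++⁺ʳ us y∈vs

  Unique-⊆⇒length≤ : ∀ {xs ys : List A} → Unique xs → xs ⊆ ys → length xs ≤ length ys
  Unique-⊆⇒length≤ [] _ = z≤n
  Unique-⊆⇒length≤ {x ∷ xs} (x∉xs ∷ !xs) xs⊆ys with ∈-∃++ (xs⊆ys (here refl))
  ... | us , vs , refl = begin
      suc (length xs)            ≤⟨ s≤s (Unique-⊆⇒length≤ !xs xs⊆us++vs) ⟩
      suc (length (us ++ vs))    ≡⟨ cong suc (length-++ us) ⟩
      suc (length us + length vs) ≡⟨ +-suc (length us) (length vs) ⟨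
      length us + suc (length vs) ≡⟨ length-++ us ⟨
      length (us ++ x ∷ vs)      ∎
    where
      open ≤-Reasoning
      xs⊆us++vs : xs ⊆ us ++ vs
      xs⊆us++vs y∈xs = ∈-++-∷⁻ us (xs⊆ys (there y∈xs)) (All.lookup x∉xs y∈xs ∘ sym)

  length-filter+length-filter-∁ : ∀ {P : A → Set} (P? : Decidable P) xs →
    length (filter P? xs) + length (filter (∁? P?) xs) ≡ length xs
  length-filter+length-filter-∁ P? [] = refl
  length-filter+length-filter-∁ P? (x ∷ xs) with P? x
  ... | yes _ = cong suc (length-filter+length-filter-∁ P? xs)
  ... | no  _ = trans (+-suc _ _) (cong suc (length-filter+length-filter-∁ P? xs))

n≤n*[n*n] : ∀ n → n ≤ n * (n * n)
n≤n*[n*n] zero    = z≤n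
n≤n*[n*n] (suc n) = m≤m*n (suc n) (suc n * suc n)

sum-map-mono-≤ : ∀ {A : Set} {g h : A → ℕ} (zs : List A) →
  (∀ z → g z ≤ h z) → sum (map g zs) ≤ sum (map h zs)
sum-map-mono-≤ []       g≤h = z≤n
sum-map-mono-≤ (z ∷ zs) g≤h = +-mono-≤ (g≤h z) (sum-map-mono-≤ zs g≤h)

sum-map≤threshold : ∀ {A : Set} (g : A → ℕ) t {B} zs → All (λ z → g z < B) zs →
  sum (map g zs) ≤ t * length zs + B * length (filter (λ z → t <? g z) zs)
sum-map≤threshold g t     []       []            = z≤n
sum-map≤threshold g t {B} (z ∷ zs) (gz<B ∷ g<B) with t <? g z
... | yes t<gz rewrite filter-accept (λ z → t <? g z) {z} {zs} t<gz = begin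
    g z + sum (map g zs)            ≤⟨ +-mono-≤ (<⇒≤ gz<B) (sum-map≤threshold g t zs g<B) ⟩
    B + (t * n + B * h)             ≤⟨ m≤n+m _ t ⟩
    t + (B + (t * n + B * h))       ≡⟨ rearrange t B n h ⟩
    t * suc n + B * suc h           ∎
  where
    open ≤-Reasoning
    open +-*-Solver
    n h : ℕ
    n = length zs
    h = length (filter (λ z → t <? g z) zs)
    rearrange : ∀ t B n h → t + (B + (t * n + B * h)) ≡ t * suc n + B * suc h
    rearrange = solve 4 (λ t B n h → t :+ (B :+ (t :* n :+ B :* h))
                                   := t :* (con 1 :+ n) :+ B :* (con 1 :+ h)) refl
... | no t≮gz rewrite filter-reject (λ z → t <? g z) {z} {zs} t≮gz = begin
    g z + sum (map g zs)            ≤⟨ +-mono-≤ (≮⇒≥ t≮gz) (sum-map≤threshold g t zs g<B) ⟩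
    t + (t * n + B * h)             ≡⟨ +-assoc t _ _ ⟨
    t + t * n + B * h               ≡⟨ cong (_+ B * h) (*-suc t n) ⟨
    t * suc n + B * h               ∎
  where
    open ≤-Reasoning
    n h : ℕ
    n = length zs
    h = length (filter (λ z → t <? g z) zs)

module _ {A : Set} (f : A → ℕ) where

  count : List A → ℕ → ℕ
  count xs z = length (filter (λ x → f x ≟ z) xs)

  count-∷-≤ : ∀ x xs z → count xs z ≤ count (x ∷ xs) z
  count-∷-≤ x xs z with f x ≟ z
  ... | yes fx≡z = ≤-trans (n≤1+n _) (≤-reflexive (sym (cong length (filter-accept (λ x → f x ≟ z) {x} {xs} fx≡z))))
  ... | no  fx≢z = ≤-reflexive (sym (cong length (filter-reject (λ x → f x ≟ z) {x} {xs} fx≢z)))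

  sum-count-∷ : ∀ x xs {zs} → f x ∈ zs →
    suc (sum (map (count xs) zs)) ≤ sum (map (count (x ∷ xs)) zs)
  sum-count-∷ x xs {z ∷ zs} (here fx≡z) = +-mono-≤
    (≤-reflexive (sym (cong length (filter-accept (λ x → f x ≟ z) {x} {xs} fx≡z))))
    (sum-map-mono-≤ zs (count-∷-≤ x xs))
  sum-count-∷ x xs {z ∷ zs} (there fx∈zs) = ≤-trans
    (≤-reflexive (sym (+-suc (count xs z) _)))
    (+-mono-≤ (count-∷-≤ x xs z) (sum-count-∷ x xs fx∈zs))

  length≤sum-count : ∀ xs {zs} → All (λ x → f x ∈ zs) xs → length xs ≤ sum (map (count xs) zs)
  length≤sum-count []       []           = z≤n
  length≤sum-count (x ∷ xs) (fx∈ ∷ f∈) = ≤-trans (s≤s (length≤sum-count xs f∈)) (sum-count-∷ x xs fx∈)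

  frequent-value : ∀ {t k ℓ B} xs zs → 0 < B → All (λ x → f x ∈ zs) xs →
    ℓ * B ≤ length xs → t * length zs ≤ B →
    length (filter (λ z → t <? count xs z) zs) < k → k < ℓ →
    Any (λ z → B ≤ count xs z) zs
  frequent-value {t} {k} {ℓ} {B} xs zs 0<B f∈ ℓB≤ tzs≤B few k<ℓ
    with Any.any? (λ z → B ≤? count xs z) zs
  ... | yes frequent = frequent
  ... | no  ¬frequent = ⊥-elim (<⇒≱ k<ℓ (*-cancelʳ-≤ ℓ k B {{>-nonZero 0<B}} ℓB≤kB))
    where
      open ≤-Reasoning
      h : ℕ
      h = length (filter (λ z → t <? count xs z) zs)
      ℓB≤kB : ℓ * B ≤ k * B
      ℓB≤kB = begin
        ℓ * B                                ≤⟨ ℓB≤ ⟩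
        length xs                            ≤⟨ length≤sum-count xs f∈ ⟩
        sum (map (count xs) zs)              ≤⟨ sum-map≤threshold (count xs) t zs
                                                  (All.map ≰⇒> (All.¬Any⇒All¬ zs ¬frequent)) ⟩
        t * length zs + B * h                ≤⟨ +-monoˡ-≤ (B * h) tzs≤B ⟩
        B + B * h                            ≡⟨ *-suc B h ⟨
        B * suc h                            ≤⟨ *-monoʳ-≤ B few ⟩
        B * k                                ≡⟨ *-comm B k ⟩
        k * B                                ∎

sold? : ∀ {m} (μ : Matching m) h → Dec (Sold μ h)
sold? μ h = any? (λ a → τ μ a ≟ h)

module _ {m : ℕ} (μ : Matching m) (b : Fin m) {h : ℕ} (h-unsold : ¬ Sold μ h) where

  reassign : Matching m
  reassign = record { τ = τ′ ; inj = τ′-injective }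
    where
      τ′ : Fin m → ℕ
      τ′ a with a ≟ᶠ b
      ... | yes _ = h
      ... | no  _ = τ μ a
      τ′-injective : Injective _≡_ _≡_ τ′
      τ′-injective {x} {y} eq with x ≟ᶠ b | y ≟ᶠ b
      ... | yes x≡b | yes y≡b = trans x≡b (sym y≡b)
      ... | yes _   | no  _   = ⊥-elim (h-unsold (y , sym eq))
      ... | no  _   | yes _   = ⊥-elim (h-unsold (x , eq))
      ... | no  _   | no  _   = inj μ eq

  reassign-moved : τ reassign b ≡ h
  reassign-moved with b ≟ᶠ b
  ... | yes _   = refl
  ... | no  b≢b = ⊥-elim (b≢b refl)

  reassign-others : ∀ a → a ≢ b → τ reassign a ≡ τ μ a
  reassign-others a a≢b with a ≟ᶠ b
  ... | yes a≡b = ⊥-elim (a≢b a≡b)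
  ... | no  _   = refl

module _ {m : ℕ} (P : Preferences m) where

  choice : Fin m → ℕ → ℕ
  choice a = Bijection.to (P a)

  -- Listed last choice first.
  firstChoices : Fin m → ℕ → List ℕ
  firstChoices a = applyDownFrom (choice a)

  firstChoices-Unique : ∀ a i → Unique (firstChoices a i)
  firstChoices-Unique a i = Unique.applyDownFrom⁺₁ (choice a) i
    (λ j<i _ eq → <⇒≢ j<i (sym (Bijection.injective (P a) eq)))

  Forced : ℕ → Set
  Forced h = ∀ μ → IsPOM P μ → Sold μ h

  IsPOM⇒¬prefers-unsold : ∀ {h} μ → IsPOM P μ → ¬ Sold μ h → ∀ b → ¬ Prefers P b h (τ μ b)
  IsPOM⇒¬prefers-unsold μ pom h-unsold b b-prefers =
    pom (⁅ b ⁆ , reassign μ b h-unsold , (b , x∈⁅x⁆ b) , unchanged , improved)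
    where
      unchanged : ∀ a → a ∉ₛ ⁅ b ⁆ → τ (reassign μ b h-unsold) a ≡ τ μ a
      unchanged a a∉ = reassign-others μ b h-unsold a (λ { refl → a∉ (x∈⁅x⁆ b) })
      improved : ∀ a → a ∈ₛ ⁅ b ⁆ → Prefers P a (τ (reassign μ b h-unsold) a) (τ μ a)
      improved a a∈ with x∈⁅y⁆⇒x≡y b a∈
      ... | refl = subst (λ h′ → Prefers P a h′ (τ μ a)) (sym (reassign-moved μ b h-unsold)) b-prefers

  unsold-choice⇒assigned-earlier : ∀ μ → IsPOM P μ → ∀ b p →
    ¬ Sold μ (choice b p) → τ μ b ∈ firstChoices b p
  unsold-choice⇒assigned-earlier μ pom b p unsold
    with Bijection.strictlySurjective (P b) (τ μ b)
  ... | q , choice-q≡τb with <-cmp q p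
  ... | tri< q<p _ _ = subst (_∈ firstChoices b p) choice-q≡τb (∈-applyDownFrom⁺ (choice b) q<p)
  ... | tri≈ _ refl _ = ⊥-elim (unsold (b , sym choice-q≡τb))
  ... | tri> _ _ p<q = ⊥-elim (IsPOM⇒¬prefers-unsold μ pom unsold b (p , q , p<q , refl , choice-q≡τb))

  SharePrefix : ℕ → List ℕ → List (Fin m) → Set
  SharePrefix i H bs = All (λ b → firstChoices b i ≡ H) bs

  length-unsold-next≤ : ∀ {i H bs} μ → IsPOM P μ → Unique bs → SharePrefix i H bs →
    All (λ b → ¬ Sold μ (choice b i)) bs → length bs ≤ length H
  length-unsold-next≤ {i} {H} {bs} μ pom !bs share unsold = begin
    length bs           ≡⟨ length-map (τ μ) bs ⟨
    length (map (τ μ) bs) ≤⟨ Unique-⊆⇒length≤ (Unique.map⁺ (inj μ) !bs) assigned∈H ⟩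
    length H            ∎
    where
      open ≤-Reasoning
      assigned∈H : map (τ μ) bs ⊆ H
      assigned∈H y∈ with ∈-map⁻ (τ μ) y∈
      ... | b , b∈bs , refl = subst (τ μ b ∈_) (All.lookup share b∈bs)
        (unsold-choice⇒assigned-earlier μ pom b i (All.lookup unsold b∈bs))

  popular⇒forced : ∀ {i H bs z} → Unique bs → SharePrefix i H bs →
    length H < count (λ b → choice b i) bs z → Forced z
  popular⇒forced {i} {H} {bs} {z} !bs share H<count μ pom with sold? μ z
  ... | yes sold   = sold
  ... | no  unsold = ⊥-elim (<⇒≱ H<count
    (length-unsold-next≤ μ pom (Unique.filter⁺ _ !bs) (All.filter⁺ _ share)
      (All.map (λ choice≡z → unsold ∘ subst (Sold μ) choice≡z) (All.all-filter _ bs))))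

  spread⇒mostly-sold : ∀ {i t H bs zs} μ → IsPOM P μ → Unique bs → SharePrefix i H bs →
    length H ≤ t → Unique zs → zs ⊆ map (λ b → choice b i) bs →
    SoldInAtLeast μ zs (length zs ∸ t)
  spread⇒mostly-sold {i} {t} {H} {bs} {zs} μ pom !bs share H≤t !zs zs⊆ =
    sold , Unique.filter⁺ _ !zs , proj₁ ∘ ∈-filter⁻ (sold? μ) , m≤n+o⇒m∸n≤o _ t zs≤t+sold ,
    All.all-filter _ zs
    where
      open ≤-Reasoning
      next : Fin m → ℕ
      next b = choice b i
      sold unsold : List ℕ
      sold   = filter (sold? μ) zs
      unsold = filter (∁? (sold? μ)) zs
      stuck : List (Fin m)
      stuck  = filter (∁? (sold? μ ∘ next)) bs
      unsold⊆ : unsold ⊆ map next stuck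
      unsold⊆ z∈ with ∈-filter⁻ (∁? (sold? μ)) z∈
      ... | z∈zs , z-unsold with ∈-map⁻ next (zs⊆ z∈zs)
      ... | b , b∈bs , refl = ∈-map⁺ next (∈-filter⁺ (∁? (sold? μ ∘ next)) b∈bs z-unsold)
      zs≤t+sold : length zs ≤ t + length sold
      zs≤t+sold = begin
        length zs                          ≡⟨ length-filter+length-filter-∁ (sold? μ) zs ⟨
        length sold + length unsold        ≤⟨ +-monoʳ-≤ (length sold) (begin
          length unsold                      ≤⟨ Unique-⊆⇒length≤ (Unique.filter⁺ _ !zs) unsold⊆ ⟩
          length (map next stuck)            ≡⟨ length-map next stuck ⟩
          length stuck                       ≤⟨ length-unsold-next≤ μ pom (Unique.filter⁺ _ !bs)
                                                  (All.filter⁺ _ share) (All.all-filter _ bs) ⟩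
          length H                           ≤⟨ H≤t ⟩
          t                                  ∎) ⟩
        length sold + t                    ≡⟨ +-comm (length sold) t ⟩
        t + length sold                    ∎

  Dichotomy : ℕ → ℕ → Set
  Dichotomy k ℓ = CoreAtLeast P k ⊎ Σ (List ℕ) (λ X → Unique X × ℓ * ℓ ≤ length X
    × ((μ : Matching m) → IsPOM P μ → SoldInAtLeast μ X (length X ∸ ℓ)))

  record Stage (i B : ℕ) : Set where
    field
      prefix        : List ℕ
      buyers        : List (Fin m)
      length-prefix : length prefix ≡ i
      buyers-Unique : Unique buyers
      shared        : SharePrefix i prefix buyers
      prefix-forced : All Forced prefix
      many-buyers   : B ≤ length buyers

  Stage⇒CoreAtLeast : ∀ {i B} → 0 < B → Stage i B → CoreAtLeast P i
  Stage⇒CoreAtLeast {i} 0<B st with Stage.buyers st | Stage.shared st | Stage.many-buyers st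
  ... | []    | _         | B≤0 = ⊥-elim (<⇒≱ 0<B B≤0)
  ... | b ∷ _ | shared-b ∷ _ | _ =
    prefix , subst Unique shared-b (firstChoices-Unique b i) , ≤-reflexive (sym length-prefix) ,
    prefix-forced
    where open Stage st

  Stage-step : ∀ {i k ℓ B} → i < ℓ → k < ℓ → ℓ * (ℓ * ℓ) ≤ B →
    Stage i (ℓ * B) → Dichotomy k ℓ ⊎ Stage (suc i) B
  Stage-step {i} {k} {ℓ} {B} i<ℓ k<ℓ ℓ³≤B st = cases
    where
      open Stage st
      next : Fin m → ℕ
      next b = choice b i
      nexts popular : List ℕ
      nexts   = deduplicate _≟_ (map next buyers)
      popular = filter (λ z → i <? count next buyers z) nexts
      i<B : i < B
      i<B = <-≤-trans i<ℓ (≤-trans (n≤n*[n*n] ℓ) ℓ³≤B)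
      popular-forced : ∀ {z} → i < count next buyers z → Forced z
      popular-forced {z} = popular⇒forced buyers-Unique shared ∘ subst (_< count next buyers z) (sym length-prefix)
      refine : ∀ {z} → B ≤ count next buyers z → Stage (suc i) B
      refine {z} B≤count = record
        { prefix        = z ∷ prefix
        ; buyers        = filter (λ b → next b ≟ z) buyers
        ; length-prefix = cong suc length-prefix
        ; buyers-Unique = Unique.filter⁺ _ buyers-Unique
        ; shared        = All.zipWith (λ (next≡z , shared-b) → cong₂ _∷_ next≡z shared-b)
                            (All.all-filter _ buyers , All.filter⁺ _ shared)
        ; prefix-forced = popular-forced (<-≤-trans i<B B≤count) ∷ prefix-forced
        ; many-buyers   = B≤count
        }
      cases : Dichotomy k ℓ ⊎ Stage (suc i) B
      cases with ℓ * ℓ ≤? length nexts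
      ... | yes spread = inj₁ (inj₂ (nexts , deduplicate-! _≟_ _ , spread , λ μ pom →
            spread⇒mostly-sold μ pom buyers-Unique shared (≤-trans (≤-reflexive length-prefix) (<⇒≤ i<ℓ))
              (deduplicate-! _≟_ _) (∈-deduplicate⁻ _≟_ _)))
      ... | no narrow with k ≤? length popular
      ... | yes many = inj₁ (inj₁ (popular , Unique.filter⁺ _ (deduplicate-! _≟_ (map next buyers)) , many ,
            All.map popular-forced (All.all-filter _ nexts)))
      ... | no few = inj₂ (refine (proj₂ (Any.satisfied (frequent-value next buyers nexts
            (≤-<-trans z≤n i<B) (All.tabulate (∈-deduplicate⁺ _≟_ ∘ ∈-map⁺ next)) many-buyers
            (≤-trans (*-mono-≤ (<⇒≤ i<ℓ) (<⇒≤ (≰⇒> narrow))) ℓ³≤B) (≰⇒> few) k<ℓ))))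

  iterate : ∀ {k} j i → i + j ≡ k → Stage i ((4 + k) ^ (j + 4)) → Dichotomy k (4 + k)
  iterate {k} zero i i+0≡k st =
    inj₁ (subst (CoreAtLeast P) (trans (sym (+-identityʳ i)) i+0≡k) (Stage⇒CoreAtLeast (m^n>0 (4 + k) 4) st))
  iterate {k} (suc j) i i+1+j≡k st =
    [ (λ done → done) , iterate j (suc i) (trans (sym (+-suc i j)) i+1+j≡k) ]′ (Stage-step i<ℓ k<ℓ ℓ³≤B st)
    where
      ℓ : ℕ
      ℓ = 4 + k
      k<ℓ : k < ℓ
      k<ℓ = m<n+m k (s≤s z≤n)
      i<ℓ : i < ℓ
      i<ℓ = <-≤-trans (subst (i <_) i+1+j≡k (m<m+n i (s≤s z≤n))) (<⇒≤ k<ℓ)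
      ℓ³≤B : ℓ * (ℓ * ℓ) ≤ ℓ ^ (j + 4)
      ℓ³≤B = subst (_≤ ℓ ^ (j + 4)) (cong (λ x → ℓ * (ℓ * x)) (*-identityʳ ℓ))
               (^-monoʳ-≤ ℓ (≤-trans (n≤1+n 3) (m≤n+m 4 j)))

  dichotomy : ∀ k → (4 + k) ^ (4 + k) ≤ m → Dichotomy k (4 + k)
  dichotomy k ℓ^ℓ≤m = iterate k 0 refl (record
    { prefix        = []
    ; buyers        = allFin m
    ; length-prefix = refl
    ; buyers-Unique = Unique.allFin⁺ m
    ; shared        = All.tabulate (λ _ → refl)
    ; prefix-forced = []
    ; many-buyers   = subst₂ _≤_ (cong ((4 + k) ^_) (+-comm 4 k)) (sym (length-tabulate (λ a → a))) ℓ^ℓ≤m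
    })

lemma3 : (m ℓ : ℕ) → 1 ≤ m → ℓ ^ ℓ ≤ m → m < suc ℓ ^ suc ℓ →
         (P : Preferences m) →
         CoreAtLeast P (ℓ ∸ 4)
         ⊎ Σ (List ℕ) (λ X → Unique X × ℓ * ℓ ≤ length X
             × ((μ : Matching m) → IsPOM P μ → SoldInAtLeast μ X (length X ∸ ℓ)))
lemma3 m 0                          _ _     _ P = inj₁ ([] , [] , z≤n , [])
lemma3 m 1                          _ _     _ P = inj₁ ([] , [] , z≤n , [])
lemma3 m 2                          _ _     _ P = inj₁ ([] , [] , z≤n , [])
lemma3 m 3                          _ _     _ P = inj₁ ([] , [] , z≤n , [])
lemma3 m (suc (suc (suc (suc k)))) _ ℓ^ℓ≤m _ P = dichotomy P k ℓ^ℓ≤m
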